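{- Let $k$ be a positive integer and $G$ a self-complementary split graph on $4k$ vertices. Then $G$ has a unique split partition, and it is $\{v\mid d(v)\ge 2k\}\uplus\{v\mid d(v)<2k\}$ (the first set being the clique and the second the independent set).
   Context: Graphs are finite and simple; $d(v)$ is the degree of $v$ in $G$. A graph is self-complementary if it is isomorphic to its complement. A split graph is a graph whose vertex set can be partitioned into a clique $K$ and an independent set $I$; such a partition $K\uplus I$ is a split partition. -}

module Defs where

open import Data.Nat using (ℕ; _≤?_)
open import Data.Bool using (Bool; true; false; not; if_then_else_)
open import Data.Empty using (⊥-elim)
open import Data.Fin using (Fin; _≟_)
open import Data.Fin.Subset using (Subset; ∣_∣)
open import Data.Fin.Permutation using (Permutation′; _⟨$⟩ʳ_)
open import Data.Vec using (tabulate)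
open import Data.Product using (Σ; _×_)
open import Relation.Nullary using (¬_; does; yes; no)
open import Relation.Binary.PropositionalEquality using (_≡_; refl; cong; sym)

record Graph (n : ℕ) : Set where
  field
    adj    : Fin n → Fin n → Bool
    adj-sym : ∀ i j → adj i j ≡ adj j i
    irrefl : ∀ i → adj i i ≡ false
open Graph public

degree : ∀ {n} → Graph n → Fin n → ℕ
degree G v = ∣ tabulate (adj G v) ∣

complement : ∀ {n} → Graph n → Graph n
complement {n} G = record { adj = a ; adj-sym = s ; irrefl = r }
  where
  a : Fin n → Fin n → Bool
  a i j = if does (i ≟ j) then false else not (adj G i j)
  s : ∀ i j → a i j ≡ a j i
  s i j with i ≟ j | j ≟ i
  ... | yes _ | yes _ = refl
  ... | yes p | no q = ⊥-elim (q (sym p))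
  ... | no p | yes q = ⊥-elim (p (sym q))
  ... | no _ | no _ = cong not (adj-sym G i j)
  r : ∀ i → a i i ≡ false
  r i with i ≟ i
  ... | yes _ = refl
  ... | no ¬p = ⊥-elim (¬p refl)

Isomorphic : ∀ {n} → Graph n → Graph n → Set
Isomorphic {n} G H =
  Σ (Permutation′ n) λ σ → ∀ i j → adj G i j ≡ adj H (σ ⟨$⟩ʳ i) (σ ⟨$⟩ʳ j)

SelfComplementary : ∀ {n} → Graph n → Set
SelfComplementary G = Isomorphic G (complement G)

-- A split partition K ⊎ I is represented by its indicator P : Fin n → Bool,
-- with K = {v | P v ≡ true} and I = {v | P v ≡ false}.
IsClique : ∀ {n} → Graph n → (Fin n → Bool) → Set
IsClique G P = ∀ i j → ¬ i ≡ j → P i ≡ true → P j ≡ true → adj G i j ≡ true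

IsIndependent : ∀ {n} → Graph n → (Fin n → Bool) → Set
IsIndependent G P = ∀ i j → P i ≡ false → P j ≡ false → adj G i j ≡ false

IsSplitPartition : ∀ {n} → Graph n → (Fin n → Bool) → Set
IsSplitPartition G P = IsClique G P × IsIndependent G P

IsSplit : ∀ {n} → Graph n → Set
IsSplit {n} G = Σ (Fin n → Bool) λ P → IsSplitPartition G P

degreePartition : ∀ {n} → Graph n → ℕ → Fin n → Bool
degreePartition G m v = does (m ≤? degree G v)

{-# OPTIONS --safe #-}

-- Let M = 2(k+1) and let σ be an isomorphism from G onto its complement. Since
-- d(v) + d(σ v) = 2M − 1, σ maps the high-degree vertices {d ≥ M} into the low-degree
-- ones and back, so each class has at most (hence exactly) M vertices. In a split
-- partition K ⊎ I, a vertex of K has degree ≥ |K| − 1 and a vertex of I has degree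
-- ≤ |K|. If |K| > M, then K is contained in the high class, which is too small; so
-- |K| ≤ M and every vertex of I has degree ≤ M. Degree exactly M would force
-- N(v) = K, and then K ∪ {v} would be the clique of a split partition of size M + 1.
-- Thus I lies in the low class, and |I| ≥ M forces equality.

module Submission where

open import Defs
open import Data.Nat using (ℕ; zero; suc; _+_; _*_; _≤_; _<_; z≤n; s≤s; _≤?_)
open import Data.Nat.Properties
  using (≤-trans; ≤-pred; m≤n+m; +-suc; +-mono-<; <-≤-trans; <-irrefl; <⇒≱; ≰⇒>; ≮⇒≥;
         +-monoˡ-≤; +-cancelˡ-≤; +-mono-≤; +-comm; ≤-refl; ≤-reflexive; *-distribʳ-+; ≤∧≢⇒<;
         +-0-commutativeMonoid; module ≤-Reasoning)
open import Data.Bool using (Bool; true; false; not; _∨_; if_then_else_)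
open import Data.Bool.Properties using (not-injective)
open import Data.Fin using (Fin; zero; suc; _≟_)
open import Data.Fin.Subset using (∣_∣)
open import Data.Fin.Permutation using (Permutation′; _⟨$⟩ʳ_)
open import Data.Vec using (tabulate)
open import Data.Product using (_×_; _,_; proj₁)
open import Data.Sum using (_⊎_; inj₁; inj₂)
open import Function using (_∘_)
open import Relation.Nullary using (¬_; Dec; does; yes; no; contradiction)
open import Relation.Nullary.Decidable using (dec-true; dec-false)
open import Relation.Binary.PropositionalEquality
  using (_≡_; _≢_; _≗_; refl; sym; trans; cong; cong₂; subst; module ≡-Reasoning)
open import Algebra.Properties.CommutativeMonoid.Sum +-0-commutativeMonoid
  using (sum; sum-cong-≗; sum-permute)

count : ∀ {n} → (Fin n → Bool) → ℕ
count P = sum (λ i → if P i then 1 else 0)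

infix 4 _⊆_

_⊆_ : ∀ {n} → (Fin n → Bool) → (Fin n → Bool) → Set
P ⊆ Q = ∀ i → P i ≡ true → Q i ≡ true

insert : ∀ {n} → Fin n → (Fin n → Bool) → Fin n → Bool
insert v P i = does (i ≟ v) ∨ P i

count-cong : ∀ {n} {P Q : Fin n → Bool} → P ≗ Q → count P ≡ count Q
count-cong P≗Q = sum-cong-≗ (cong (λ b → if b then 1 else 0) ∘ P≗Q)

count-mono : ∀ {n} (P Q : Fin n → Bool) → P ⊆ Q → count P ≤ count Q
count-mono {zero}  P Q P⊆Q = z≤n
count-mono {suc n} P Q P⊆Q with P zero in P₀ | Q zero in Q₀
... | false | _     = ≤-trans (count-mono (P ∘ suc) (Q ∘ suc) (P⊆Q ∘ suc)) (m≤n+m _ _)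
... | true  | true  = s≤s (count-mono (P ∘ suc) (Q ∘ suc) (P⊆Q ∘ suc))
... | true  | false = contradiction (trans (sym (P⊆Q zero P₀)) Q₀) λ ()

count-not : ∀ {n} (P : Fin n → Bool) → count P + count (not ∘ P) ≡ n
count-not {zero}  P = refl
count-not {suc n} P with P zero
... | true  = cong suc (count-not (P ∘ suc))
... | false = trans (+-suc (count (P ∘ suc)) _) (cong suc (count-not (P ∘ suc)))

count-insert : ∀ {n} (P : Fin n → Bool) (v : Fin n) → P v ≡ false →
               count (insert v P) ≡ suc (count P)
count-insert {suc n} P zero Pv rewrite Pv = refl
count-insert {suc n} P (suc v) Pv =
  trans (cong ((if P zero then 1 else 0) +_) (count-insert (P ∘ suc) v Pv)) (+-suc _ _)

count-permute : ∀ {n} (P : Fin n → Bool) (σ : Permutation′ n) →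
                count (λ i → P (σ ⟨$⟩ʳ i)) ≡ count P
count-permute P σ = sym (sum-permute (λ i → if P i then 1 else 0) σ)

count-mono-permute : ∀ {n} (P Q : Fin n → Bool) (σ : Permutation′ n) →
                     P ⊆ Q ∘ (σ ⟨$⟩ʳ_) → count P ≤ count Q
count-mono-permute P Q σ P⊆Q∘σ =
  ≤-trans (count-mono P (Q ∘ (σ ⟨$⟩ʳ_)) P⊆Q∘σ) (≤-reflexive (count-permute Q σ))

⊆∧count≤⇒≗ : ∀ {n} (P Q : Fin n → Bool) → P ⊆ Q → count Q ≤ count P → P ≗ Q
⊆∧count≤⇒≗ P Q P⊆Q cQ≤cP i with P i in Pᵢ | Q i in Qᵢ
... | true  | true  = refl
... | false | false = refl
... | true  | false = contradiction (trans (sym (P⊆Q i Pᵢ)) Qᵢ) λ ()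
... | false | true  = contradiction cQ≤cP (<⇒≱ (subst (_≤ count Q) (count-insert P i Pᵢ)
                                         (count-mono (insert i P) Q insertᵢP⊆Q)))
  where
  insertᵢP⊆Q : insert i P ⊆ Q
  insertᵢP⊆Q j e with j ≟ i
  ... | yes refl = Qᵢ
  ... | no _     = P⊆Q j e

count-tabulate : ∀ {n} (P : Fin n → Bool) → ∣ tabulate P ∣ ≡ count P
count-tabulate {zero}  P = refl
count-tabulate {suc n} P with P zero
... | true  = cong suc (count-tabulate (P ∘ suc))
... | false = count-tabulate (P ∘ suc)

insert⁻ : ∀ {n} (P : Fin n → Bool) {v i : Fin n} → insert v P i ≡ true → i ≡ v ⊎ P i ≡ true
insert⁻ P {v} {i} e with i ≟ v
... | yes i≡v = inj₁ i≡v
... | no _    = inj₂ e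

insert-false : ∀ {n} (P : Fin n → Bool) {v i : Fin n} → insert v P i ≡ false → P i ≡ false
insert-false P {v} {i} e with i ≟ v
... | no _ = e

≤∧+≡double⇒≤ : ∀ {a b m} → a ≤ b → a + b ≡ m + m → a ≤ m
≤∧+≡double⇒≤ a≤b a+b≡m+m = ≮⇒≥ λ m<a →
  <-irrefl (sym a+b≡m+m) (+-mono-< m<a (<-≤-trans m<a a≤b))

≤∧+≡double⇒≥ : ∀ {a b m} → a ≤ m → a + b ≡ m + m → m ≤ b
≤∧+≡double⇒≥ {a} {b} {m} a≤m a+b≡m+m =
  +-cancelˡ-≤ m m b (subst (_≤ m + b) a+b≡m+m (+-monoˡ-≤ b a≤m))

does≡true⇒ : ∀ {a} {A : Set a} (a? : Dec A) → does a? ≡ true → A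
does≡true⇒ (yes a) refl = a

does≡false⇒ : ∀ {a} {A : Set a} (a? : Dec A) → does a? ≡ false → ¬ A
does≡false⇒ (no ¬a) refl = ¬a

suc[a+b]≡m+m∧m≤a⇒b<m : ∀ {a b m} → suc (a + b) ≡ m + m → m ≤ a → b < m
suc[a+b]≡m+m∧m≤a⇒b<m {a} {b} eq m≤a =
  ≰⇒> λ m≤b → <⇒≱ (subst (a + b <_) eq ≤-refl) (+-mono-≤ m≤a m≤b)

suc[a+b]≡m+m∧a<m⇒m≤b : ∀ {a b m} → suc (a + b) ≡ m + m → a < m → m ≤ b
suc[a+b]≡m+m∧a<m⇒m≤b {a} {b} {m} eq a<m = ≮⇒≥ λ b<m →
  <-irrefl refl (subst (suc (suc (a + b)) ≤_) (sym eq)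
                  (subst (_≤ m + m) (cong suc (+-suc a b)) (+-mono-≤ a<m b<m)))

degree≡count : ∀ {n} (G : Graph n) v → degree G v ≡ count (adj G v)
degree≡count G v = count-tabulate (adj G v)

module _ {n} (G : Graph n) where

  insert-complement-neighbours : ∀ v → insert v (adj (complement G) v) ≗ not ∘ adj G v
  insert-complement-neighbours v i with i ≟ v | v ≟ i
  ... | yes refl | _       = cong not (sym (irrefl G i))
  ... | no i≢v   | yes v≡i = contradiction (sym v≡i) i≢v
  ... | no _     | no _    = refl

  degree+degree-complement : ∀ v → suc (degree G v + degree (complement G) v) ≡ n
  degree+degree-complement v = begin
    suc (degree G v + degree Gᶜ v)
      ≡⟨ +-suc (degree G v) _ ⟨
    degree G v + suc (degree Gᶜ v)
      ≡⟨ cong₂ _+_ (degree≡count G v) (cong suc (degree≡count Gᶜ v)) ⟩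
    count (adj G v) + suc (count (adj Gᶜ v))
      ≡⟨ cong (count (adj G v) +_) (count-insert (adj Gᶜ v) v (irrefl Gᶜ v)) ⟨
    count (adj G v) + count (insert v (adj Gᶜ v))
      ≡⟨ cong (count (adj G v) +_) (count-cong (insert-complement-neighbours v)) ⟩
    count (adj G v) + count (not ∘ adj G v)
      ≡⟨ count-not (adj G v) ⟩
    n ∎
    where
    open ≡-Reasoning
    Gᶜ : Graph n
    Gᶜ = complement G

  degree-isomorphic : ∀ {H} ((σ , σ-adj) : Isomorphic G H) v →
                      degree G v ≡ degree H (σ ⟨$⟩ʳ v)
  degree-isomorphic {H} (σ , σ-adj) v = begin
    degree G v                          ≡⟨ degree≡count G v ⟩
    count (adj G v)                     ≡⟨ count-cong (σ-adj v) ⟩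
    count (λ j → adj H w (σ ⟨$⟩ʳ j))    ≡⟨ count-permute (adj H w) σ ⟩
    count (adj H w)                     ≡⟨ count-tabulate (adj H w) ⟨
    degree H w                          ∎
    where
    open ≡-Reasoning
    w : Fin n
    w = σ ⟨$⟩ʳ v

  isSplitPartition-cong : ∀ {P Q} → P ≗ Q → IsSplitPartition G P → IsSplitPartition G Q
  isSplitPartition-cong P≗Q (clique , independent) =
    (λ i j i≢j Qi Qj → clique i j i≢j (trans (P≗Q i) Qi) (trans (P≗Q j) Qj)) ,
    (λ i j Qi Qj → independent i j (trans (P≗Q i) Qi) (trans (P≗Q j) Qj))

  clique-size≤1+degree : ∀ {P} → IsClique G P → ∀ {u} → P u ≡ true → count P ≤ suc (degree G u)
  clique-size≤1+degree {P} clique {u} Pu = begin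
    count P                         ≤⟨ count-mono P (insert u (adj G u)) P⊆insert ⟩
    count (insert u (adj G u))      ≡⟨ count-insert (adj G u) u (irrefl G u) ⟩
    suc (count (adj G u))           ≡⟨ cong suc (degree≡count G u) ⟨
    suc (degree G u)                ∎
    where
    open ≤-Reasoning
    P⊆insert : P ⊆ insert u (adj G u)
    P⊆insert i Pi with i ≟ u
    ... | yes _   = refl
    ... | no  i≢u = clique u i (i≢u ∘ sym) Pu Pi

  neighbours⊆clique : ∀ {P} → IsIndependent G P → ∀ {v} → P v ≡ false → adj G v ⊆ P
  neighbours⊆clique {P} independent {v} Pv i vi with P i in Pi
  ... | true  = refl
  ... | false = contradiction (trans (sym vi) (independent v i Pv Pi)) λ ()

  degree≤clique-size : ∀ {P} → IsIndependent G P → ∀ {v} → P v ≡ false → degree G v ≤ count P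
  degree≤clique-size {P} independent {v} Pv =
    subst (_≤ count P) (sym (degree≡count G v))
      (count-mono (adj G v) P (neighbours⊆clique independent Pv))

  insert-isSplitPartition : ∀ {P} → IsSplitPartition G P → ∀ {v} → P ⊆ adj G v →
                            IsSplitPartition G (insert v P)
  insert-isSplitPartition {P} (clique , independent) {v} P⊆Nv = clique⁺ , independent⁺
    where
    clique⁺ : IsClique G (insert v P)
    clique⁺ i j i≢j Pi Pj with insert⁻ P Pi | insert⁻ P Pj
    ... | inj₁ refl | inj₁ refl = contradiction refl i≢j
    ... | inj₁ refl | inj₂ Pj   = P⊆Nv j Pj
    ... | inj₂ Pi   | inj₁ refl = trans (adj-sym G i j) (P⊆Nv i Pi)
    ... | inj₂ Pi   | inj₂ Pj   = clique i j i≢j Pi Pj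
    independent⁺ : IsIndependent G (insert v P)
    independent⁺ i j Pi Pj = independent i j (insert-false P Pi) (insert-false P Pj)

module SelfComplementarySplit {n M} (n≡M+M : n ≡ M + M) (G : Graph n)
                              (sc : SelfComplementary G) where

  σ : Permutation′ n
  σ = proj₁ sc

  high : Fin n → Bool
  high = degreePartition G M

  low : Fin n → Bool
  low = not ∘ high

  high-intro : ∀ {v} → M ≤ degree G v → high v ≡ true
  high-intro {v} = dec-true (M ≤? degree G v)

  low-intro : ∀ {v} → degree G v < M → high v ≡ false
  low-intro {v} = dec-false (M ≤? degree G v) ∘ <⇒≱

  high-elim : ∀ {v} → high v ≡ true → M ≤ degree G v
  high-elim {v} = does≡true⇒ (M ≤? degree G v)

  low-elim : ∀ {v} → high v ≡ false → degree G v < M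
  low-elim {v} = ≰⇒> ∘ does≡false⇒ (M ≤? degree G v)

  degree+degree-image : ∀ v → suc (degree G v + degree G (σ ⟨$⟩ʳ v)) ≡ M + M
  degree+degree-image v = begin
    suc (degree G v + degree G w)
      ≡⟨ cong (λ d → suc (d + degree G w)) (degree-isomorphic G {complement G} sc v) ⟩
    suc (degree (complement G) w + degree G w)
      ≡⟨ cong suc (+-comm (degree (complement G) w) _) ⟩
    suc (degree G w + degree (complement G) w)
      ≡⟨ degree+degree-complement G w ⟩
    n
      ≡⟨ n≡M+M ⟩
    M + M ∎
    where
    open ≡-Reasoning
    w : Fin n
    w = σ ⟨$⟩ʳ v

  high⊆low∘σ : high ⊆ low ∘ (σ ⟨$⟩ʳ_)
  high⊆low∘σ v hv =
    cong not (low-intro (suc[a+b]≡m+m∧m≤a⇒b<m (degree+degree-image v) (high-elim hv)))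

  low⊆high∘σ : low ⊆ high ∘ (σ ⟨$⟩ʳ_)
  low⊆high∘σ v lv =
    high-intro (suc[a+b]≡m+m∧a<m⇒m≤b (degree+degree-image v) (low-elim (not-injective lv)))

  count-high+count-low : count high + count low ≡ M + M
  count-high+count-low = trans (count-not high) n≡M+M

  count-high≤ : count high ≤ M
  count-high≤ = ≤∧+≡double⇒≤ (count-mono-permute high low σ high⊆low∘σ) count-high+count-low

  count-low≤ : count low ≤ M
  count-low≤ = ≤∧+≡double⇒≤ (count-mono-permute low high σ low⊆high∘σ)
                            (trans (+-comm (count low) _) count-high+count-low)

  clique-size≤ : ∀ {P} → IsSplitPartition G P → count P ≤ M
  clique-size≤ {P} (clique , _) = ≮⇒≥ λ M<c →
    <⇒≱ M<c (≤-trans (count-mono P high (P⊆high M<c)) count-high≤)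
    where
    P⊆high : M < count P → P ⊆ high
    P⊆high M<c u Pu = high-intro (≤-pred (≤-trans M<c (clique-size≤1+degree G clique Pu)))

  independent⊆low : ∀ {P} → IsSplitPartition G P → ∀ {v} → P v ≡ false → degree G v < M
  independent⊆low {P} sp@(_ , independent) {v} Pv = ≤∧≢⇒< (≤-trans d≤c (clique-size≤ sp)) d≢M
    where
    d≤c : degree G v ≤ count P
    d≤c = degree≤clique-size G independent Pv
    d≢M : degree G v ≢ M
    d≢M d≡M = <⇒≱ (s≤s (subst (_≤ count P) d≡M d≤c))
                  (subst (_≤ M) (count-insert P v Pv)
                     (clique-size≤ (insert-isSplitPartition G sp P⊆Nv)))
      where
      c≤d : count P ≤ count (adj G v)
      c≤d = subst (count P ≤_) (trans (sym d≡M) (degree≡count G v)) (clique-size≤ sp)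
      P⊆Nv : P ⊆ adj G v
      P⊆Nv i Pi = trans (⊆∧count≤⇒≗ (adj G v) P (neighbours⊆clique G independent Pv) c≤d i) Pi

  split≗high : ∀ {P} → IsSplitPartition G P → P ≗ high
  split≗high {P} sp v = not-injective (⊆∧count≤⇒≗ (not ∘ P) low notP⊆low count-low≤count-notP v)
    where
    notP⊆low : not ∘ P ⊆ low
    notP⊆low u e = cong not (low-intro (independent⊆low sp (not-injective e)))
    count-low≤count-notP : count low ≤ count (not ∘ P)
    count-low≤count-notP =
      ≤-trans count-low≤ (≤∧+≡double⇒≥ (clique-size≤ sp) (trans (count-not P) n≡M+M))

lemma3 : (k : ℕ) → (G : Graph (4 * suc k)) → SelfComplementary G → IsSplit G →
    IsSplitPartition G (degreePartition G (2 * suc k))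
      × (∀ (P : Fin (4 * suc k) → Bool) → IsSplitPartition G P →
           ∀ v → P v ≡ degreePartition G (2 * suc k) v)
lemma3 k G sc (P , sp) = isSplitPartition-cong G (split≗high sp) sp , λ _ → split≗high
  where open SelfComplementarySplit {M = 2 * suc k} (*-distribʳ-+ (suc k) 2 2) G sc
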